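{- Let $D$ be a dendriform algebra over a field $k$ of characteristic zero and $\overline D=D\oplus k\mathbf 1$ its unital augmentation. Let $m\ge1$, let $a_{qj}\in D$ for $1\le j\le q\le m$, let $a_{00}\in\overline D$, and let $X\in\overline D[[\lambda]]$ satisfy $$X=a_{00}+\sum_{q=1}^m\lambda^q\,\omega_\succ^{(q+1)}(X,a_{q1},\dots,a_{qq}),$$ where $\omega_\succ^{(j+1)}(X,y_1,\dots,y_j):=(\cdots((X\succ y_1)\succ y_2)\cdots)\succ y_j$. Let $N:=1+m(m-1)/2$ and index $\{1,\dots,N\}$ by the set $I=\{0\}\cup\{(q,j):1\le j<q\le m\}$, with $0$ first and the pairs $(q,j)$ following in lexicographic order. Define the row vector $Y_m=(Y_\alpha)_{\alpha\in I}$ by $Y_0=X$ and $Y_{(q,j)}=\lambda^j\omega_\succ^{(j+1)}(X,a_{q1},\dots,a_{qj})$, and the $N\times N$ matrix $M_m$ over $D$ whose only nonzero entries are: $(M_m)_{0,0}=a_{11}$; $(M_m)_{0,(q,1)}=a_{q1}$ for $2\le q\le m$; $(M_m)_{(q,j),(q,j+1)}=a_{q,j+1}$ for $1\le j<q-1$; $(M_m)_{(q,q-1),0}=a_{qq}$ for $2\le q\le m$. Then: (i) $Y_m=(a_{00},0,\dots,0)+\lambda\, Y_m\succ M_m$, where $(Y\succ M)_\beta:=\sum_{\alpha\in I}Y_\alpha\succ M_{\alpha\beta}$; (ii) if $Z\in\overline{\mathcal M_N(D)}[[\lambda]]$ is the solution of $Z=\mathbf 1_N+\lambda\, Z\succ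 M_m$, then for $a_{00}\in D$ the vector $Y_m$ is the first row of $\bigl((a_{00}\mathbf 1_N)\prec Z^{ -1}\bigr)*Z$, and for $a_{00}=\mathbf 1$ the vector $Y_m$ is the first row of $Z$.
   Context: A dendriform algebra over $k$ is a $k$-vector space $D$ with bilinear operations $\prec,\succ$ such that $(a\prec b)\prec c=a\prec(b\prec c+b\succ c)$, $(a\succ b)\prec c=a\succ(b\prec c)$, $a\succ(b\succ c)=(a\prec b+a\succ b)\succ c$; $a*b:=a\prec b+a\succ b$ is associative. The augmentation $\overline D=D\oplus k\mathbf 1$ is defined by $a\prec\mathbf 1=a=\mathbf 1\succ a$, $\mathbf 1\prec a=0=a\succ\mathbf 1$ for $a\in D$ ($\mathbf 1\prec\mathbf 1$, $\mathbf 1\succ\mathbf 1$ undefined). $\mathcal M_N(D)$ is a dendriform algebra with $(P\prec Q)_{ij}=\sum_k P_{ik}\prec Q_{kj}$, $(P\succ Q)_{ij}=\sum_k P_{ik}\succ Q_{kj}$, augmented by the unit $\mathbf 1_N$ (diagonal with $\mathbf 1$ on the diagonal); $a_{00}\mathbf 1_N$ is the diagonal matrix with $a_{00}$ on the diagonal and $Z^{ -1}$ is the $*$-inverse of $Z$. Operations extend $\lambda$-bilinearly to formal power series. -}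

module Defs where

open import Level using (Level; _⊔_) renaming (suc to lsuc)
open import Algebra.Bundles using (CommutativeRing)
open import Algebra.Module.Bundles using (Module)
open import Algebra.Core using (Op₂)
open import Data.Nat using (ℕ; zero; suc; _∸_; _≤?_; pred)
open import Data.Fin using (Fin; toℕ)
import Data.Fin.Properties as FinP
open import Data.Maybe using (Maybe; nothing; just)
import Data.Maybe.Properties as MaybeP
open import Data.Product using (Σ; _,_; _×_; ∃; proj₁; proj₂)
import Data.Product.Properties as ProdP
open import Data.Bool using (if_then_else_)
open import Relation.Nullary using (¬_; does; yes; no)
open import Relation.Binary.Definitions using (DecidableEquality)

module _ {c ℓ} (K : CommutativeRing c ℓ) where
  open CommutativeRing K

  natK : ℕ → Carrier
  natK zero    = 0#
  natK (suc n) = 1# + natK n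

  IsField : Set (c ⊔ ℓ)
  IsField = (¬ (1# ≈ 0#)) × (∀ x → ¬ (x ≈ 0#) → ∃ λ y → (x * y) ≈ 1#)

  CharZero : Set ℓ
  CharZero = ∀ n → ¬ (natK (suc n) ≈ 0#)

record Dendriform {c ℓ c′ ℓ′} {K : CommutativeRing c ℓ} (M : Module K c′ ℓ′)
       : Set (c ⊔ ℓ ⊔ c′ ⊔ ℓ′) where
  open CommutativeRing K using () renaming (Carrier to k)
  open Module M
  infixl 7 _≺_ _≻_
  field
    _≺_ _≻_ : Op₂ Carrierᴹ
    ≺-cong : ∀ {x x′ y y′} → x ≈ᴹ x′ → y ≈ᴹ y′ → (x ≺ y) ≈ᴹ (x′ ≺ y′)
    ≻-cong : ∀ {x x′ y y′} → x ≈ᴹ x′ → y ≈ᴹ y′ → (x ≻ y) ≈ᴹ (x′ ≻ y′)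
    ≺-distribˡ : ∀ x y z → (x ≺ (y +ᴹ z)) ≈ᴹ ((x ≺ y) +ᴹ (x ≺ z))
    ≺-distribʳ : ∀ x y z → ((x +ᴹ y) ≺ z) ≈ᴹ ((x ≺ z) +ᴹ (y ≺ z))
    ≻-distribˡ : ∀ x y z → (x ≻ (y +ᴹ z)) ≈ᴹ ((x ≻ y) +ᴹ (x ≻ z))
    ≻-distribʳ : ∀ x y z → ((x +ᴹ y) ≻ z) ≈ᴹ ((x ≻ z) +ᴹ (y ≻ z))
    ≺-scalarˡ : ∀ (s : k) x y → ((s *ₗ x) ≺ y) ≈ᴹ (s *ₗ (x ≺ y))
    ≺-scalarʳ : ∀ (s : k) x y → (x ≺ (s *ₗ y)) ≈ᴹ (s *ₗ (x ≺ y))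
    ≻-scalarˡ : ∀ (s : k) x y → ((s *ₗ x) ≻ y) ≈ᴹ (s *ₗ (x ≻ y))
    ≻-scalarʳ : ∀ (s : k) x y → (x ≻ (s *ₗ y)) ≈ᴹ (s *ₗ (x ≻ y))
    dend₁ : ∀ a b c → ((a ≺ b) ≺ c) ≈ᴹ (a ≺ ((b ≺ c) +ᴹ (b ≻ c)))
    dend₂ : ∀ a b c → ((a ≻ b) ≺ c) ≈ᴹ (a ≻ (b ≺ c))
    dend₃ : ∀ a b c → (a ≻ (b ≻ c)) ≈ᴹ (((a ≺ b) +ᴹ (a ≻ b)) ≻ c)

  _∗_ : Op₂ Carrierᴹ
  a ∗ b = (a ≺ b) +ᴹ (a ≻ b)

sumTo : ∀ {a} {A : Set a} → Op₂ A → (ℕ → A) → ℕ → A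
sumTo _⊕_ f zero    = f zero
sumTo _⊕_ f (suc n) = sumTo _⊕_ f n ⊕ f (suc n)

sumFin : ∀ {a} {A : Set a} → Op₂ A → A → ∀ {n} → (Fin n → A) → A
sumFin _⊕_ ε {zero}  f = ε
sumFin _⊕_ ε {suc n} f = f Fin.zero ⊕ sumFin _⊕_ ε (λ i → f (Fin.suc i))

conv : ∀ {a b d} {A : Set a} {B : Set b} {C : Set d} →
       Op₂ C → (A → B → C) → (ℕ → A) → (ℕ → B) → ℕ → C
conv _⊕_ op f g n = sumTo _⊕_ (λ i → op (f i) (g (n ∸ i))) n

-- The index set I = {0} ∪ {(q,j) : 1 ≤ j < q ≤ m}.
-- A pair (q′ , j′) with q′ : Fin m, j′ : Fin (toℕ q′) stands for
-- q = toℕ q′ + 1, j = toℕ j′ + 1; 'nothing' stands for the index 0.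

Pair : ℕ → Set
Pair m = Σ (Fin m) (λ q → Fin (toℕ q))

qOf : ∀ {m} → Pair m → ℕ
qOf (q , j) = suc (toℕ q)

jOf : ∀ {m} → Pair m → ℕ
jOf (q , j) = suc (toℕ j)

Idx : ℕ → Set
Idx m = Maybe (Pair m)

_≟I_ : ∀ {m} → DecidableEquality (Idx m)
_≟I_ = MaybeP.≡-dec (ProdP.≡-dec FinP._≟_ FinP._≟_)

sumI : ∀ {a} {A : Set a} → Op₂ A → A → ∀ {m} → (Idx m → A) → A
sumI _⊕_ ε f = f nothing ⊕ sumFin _⊕_ ε (λ q → sumFin _⊕_ ε (λ j → f (just (q , j))))

module Ops {c ℓ c′ ℓ′} {K : CommutativeRing c ℓ} {M : Module K c′ ℓ′}
           (D : Dendriform M) (m : ℕ) where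
  open CommutativeRing K using (0#; 1#; _*_; _+_) renaming (Carrier to k; _≈_ to _≈k_)
  open Module M
  open Dendriform D

  0K 1K : k
  0K = 0#
  1K = 1#

  _≈K_ : k → k → Set ℓ
  _≈K_ = _≈k_

  0D : Carrierᴹ
  0D = 0ᴹ

  _≈D_ : Carrierᴹ → Carrierᴹ → Set ℓ′
  _≈D_ = _≈ᴹ_

  C : Set c′
  C = Carrierᴹ

  -- elements d + s·𝟏 of the augmentation D̄ = D ⊕ k𝟏
  Aug : Set (c ⊔ c′)
  Aug = C × k

  -- power series in λ
  Ser : ∀ {a} → Set a → Set a
  Ser A = ℕ → A

  infixl 6 _+S_ _+AD_
  infix 4 _≈S_ _≈Sk_ _≈A_ _≈AM_
  _+S_ : Ser C → Ser C → Ser C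
  (f +S g) n = f n +ᴹ g n

  0S : Ser C
  0S n = 0ᴹ

  _≈S_ : Ser C → Ser C → Set ℓ′
  f ≈S g = ∀ n → f n ≈ᴹ g n

  _≈Sk_ : Ser k → Ser k → Set ℓ
  f ≈Sk g = ∀ n → f n ≈k g n

  constS : ∀ {a} {A : Set a} → A → A → Ser A
  constS z x zero    = x
  constS z x (suc n) = z

  shift : ℕ → Ser C → Ser C
  shift j f n with j ≤? n
  ... | yes _ = f (n ∸ j)
  ... | no  _ = 0ᴹ

  sum1to : (ℕ → Ser C) → ℕ → Ser C
  sum1to F zero    = 0S
  sum1to F (suc n) = sum1to F n +S F (suc n)

  -- elements of D̄[[λ]] : D-part and 𝟏-part
  record ASer : Set (c ⊔ c′) where
    constructor aser
    field
      dpart : Ser C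
      spart : Ser k
  open ASer public

  _≈A_ : ASer → ASer → Set (ℓ ⊔ ℓ′)
  X ≈A Y = (dpart X ≈S dpart Y) × (spart X ≈Sk spart Y)

  constA : Aug → ASer
  constA (d , s) = aser (constS 0ᴹ d) (constS 0# s)

  injA : Ser C → ASer
  injA f = aser f (λ _ → 0#)

  _+AD_ : ASer → Ser C → ASer
  X +AD f = aser (dpart X +S f) (spart X)

  -- X ≻ y  for X ∈ D̄[[λ]], y ∈ D  (using 𝟏 ≻ y = y)
  _≻AC_ : ASer → C → Ser C
  (X ≻AC y) n = (dpart X n ≻ y) +ᴹ (spart X n *ₗ y)

  _≻SC_ : Ser C → C → Ser C
  (f ≻SC y) n = f n ≻ y

  -- omegaAux X a q n = ω_≻^{(n+2)}(X, a_{q1}, …, a_{q,n+1})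
  omegaAux : ASer → (ℕ → ℕ → C) → ℕ → ℕ → Ser C
  omegaAux X a q zero    = X ≻AC a q 1
  omegaAux X a q (suc n) = omegaAux X a q n ≻SC a q (suc (suc n))

  -- ω_≻^{(j+1)}(X, a_{q1}, …, a_{qj})   (used only for j ≥ 1)
  omega : ASer → (ℕ → ℕ → C) → ℕ → ℕ → Ser C
  omega X a q j = omegaAux X a q (pred j)

  I : Set
  I = Idx m

  sumIS : (I → Ser C) → Ser C
  sumIS F n = sumI _+ᴹ_ 0ᴹ (λ α → F α n)

  Mat : ∀ {a} → Set a → Set a
  Mat A = I → I → A

  Mm : (ℕ → ℕ → C) → Mat C
  Mm a nothing nothing = a 1 1
  Mm a nothing (just p) = if does (jOf p Data.Nat.≟ 1) then a (qOf p) 1 else 0ᴹ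
  Mm a (just p) nothing = if does (suc (jOf p) Data.Nat.≟ qOf p) then a (qOf p) (qOf p) else 0ᴹ
  Mm a (just p) (just p′) =
    if does (qOf p Data.Nat.≟ qOf p′) then
      (if does (jOf p′ Data.Nat.≟ suc (jOf p)) then a (qOf p) (suc (jOf p)) else 0ᴹ)
    else 0ᴹ

  Yvec : ASer → (ℕ → ℕ → C) → I → ASer
  Yvec X a nothing  = X
  Yvec X a (just p) = injA (shift (jOf p) (omega X a (qOf p) (jOf p)))

  vecSucc : (I → ASer) → Mat C → I → Ser C
  vecSucc Y N β = sumIS (λ α → Y α ≻AC N α β)

  evec : Aug → I → ASer
  evec a00 nothing  = constA a00
  evec a00 (just p) = injA 0S

  -- elements of \overline{M_N(D)}[[λ]] : Z = mat + sc·𝟏_N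
  record AMat : Set (c ⊔ c′) where
    constructor amat
    field
      mat : Mat (Ser C)
      sc  : Ser k
  open AMat public

  _≈AM_ : AMat → AMat → Set (ℓ ⊔ ℓ′)
  Z ≈AM W = (∀ i j → mat Z i j ≈S mat W i j) × (sc Z ≈Sk sc W)

  δ0 : Ser k
  δ0 = constS 0# 1#

  1AM : AMat
  1AM = amat (λ i j → 0S) δ0

  convD : (C → C → C) → Ser C → Ser C → Ser C
  convD = conv _+ᴹ_

  _·ₛ_ : Ser k → Ser C → Ser C
  s ·ₛ f = conv _+ᴹ_ _*ₗ_ s f

  -- Z ≻ N  for Z ∈ \overline{M_N(D)}[[λ]], N ∈ M_N(D)  (using 𝟏_N ≻ N = N)
  _≻AM_ : AMat → Mat C → Mat (Ser C)
  (Z ≻AM N) i j n = sumI _+ᴹ_ 0ᴹ (λ κ → mat Z i κ n ≻ N κ j) +ᴹ (sc Z n *ₗ N i j)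

  _*AM_ : AMat → AMat → AMat
  Z *AM W = amat
    (λ i j → sumIS (λ κ → convD _∗_ (mat Z i κ) (mat W κ j))
             +S (sc W ·ₛ mat Z i j) +S (sc Z ·ₛ mat W i j))
    (conv _+_ _*_ (sc Z) (sc W))

  diag : C → Mat C
  diag d i j = if does (i ≟I j) then d else 0ᴹ

  -- P ≺ W for P ∈ M_N(D), W ∈ \overline{M_N(D)}[[λ]]  (using P ≺ 𝟏_N = P)
  _≺CA_ : Mat C → AMat → Mat (Ser C)
  (P ≺CA W) i j n = sumI _+ᴹ_ 0ᴹ (λ κ → P i κ ≺ mat W κ j n) +ᴹ (sc W n *ₗ P i j)

  -- P * Z for P ∈ M_N(D)[[λ]], Z ∈ \overline{M_N(D)}[[λ]]  (using P * 𝟏_N = P)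
  _*SA_ : Mat (Ser C) → AMat → Mat (Ser C)
  (P *SA Z) i j = sumIS (λ κ → convD _∗_ (P i κ) (mat Z κ j)) +S (sc Z ·ₛ P i j)

  entryA : AMat → I → I → ASer
  entryA Z i β = aser (mat Z i β) (if does (i ≟I β) then sc Z else (λ _ → 0#))

-- Part (i) is a column-by-column computation: column (q,1) of M_m picks up X ≻ a_q1,
-- column (q,j+1) picks up Y_(q,j) ≻ a_(q,j+1), and column 0 collects X ≻ a_11 together
-- with the last entries Y_(q,q-1) ≻ a_qq, which is exactly the equation defining X.
--
-- For part (ii), the system V = e + λ V ≻ M_m determines V coefficientwise, by recursion on
-- the λ-degree, once the 𝟏-parts of V are fixed.  The first row of Z solves it with e = 0.
-- The first row of W = (a₀₀𝟏_N ≺ Z⁻¹) * Z solves it with e = (a₀₀,0,…,0): splitting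
-- * = ≺ + ≻, the first dendriform axiom turns the ≺-half of W into a₀₀𝟏_N ≺ (Z⁻¹ * Z),
-- whose first row is (a₀₀,0,…,0), and the third axiom, applied to Z - 𝟏_N = λ Z ≻ M_m,
-- turns the ≻-half into λ W ≻ M_m.

module Submission where

open import Defs
open import Level using (_⊔_)
open import Algebra.Bundles using (CommutativeMonoid; CommutativeRing)
open import Algebra.Module.Bundles using (Module)
open import Data.Bool using (if_then_else_)
open import Data.Bool.Properties using (if-eta)
open import Data.Empty using (⊥-elim)
open import Data.Fin using (Fin; toℕ)
open import Data.Fin.Properties using (toℕ<n)
open import Data.Maybe using (nothing; just)
open import Data.Nat using (ℕ; zero; suc; _∸_; _≤_; _<_; z≤n; s≤s; _≤?_; _≟_)
open import Data.Nat.Properties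
  using (≤-refl; m≤n⇒m≤1+n; n<1+n; <-trans; suc-injective; n∸n≡0; m<n⇒0<n∸m; +-∸-assoc)
open import Data.Product using (_×_; _,_; proj₁; proj₂)
open import Function using (_∘_)
open import Relation.Binary.PropositionalEquality as ≡ using (_≡_; _≢_; cong)
open import Relation.Nullary using (does; yes; no)
open import Relation.Nullary.Decidable using (dec-true; dec-false)

module FiniteSums {c ℓ} (CM : CommutativeMonoid c ℓ) where
  open CommutativeMonoid CM renaming (Carrier to A)
  open import Algebra.Properties.CommutativeSemigroup commutativeSemigroup using (interchange)

  ΣF : ∀ {n} → (Fin n → A) → A
  ΣF = sumFin _∙_ ε

  ΣT : (ℕ → A) → ℕ → A
  ΣT = sumTo _∙_

  ΣI : ∀ {m} → (Idx m → A) → A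
  ΣI = sumI _∙_ ε

  ε∙ε≈ε : (ε ∙ ε) ≈ ε
  ε∙ε≈ε = identityˡ ε

  ΣF-cong : ∀ {n} {f g : Fin n → A} → (∀ i → f i ≈ g i) → ΣF f ≈ ΣF g
  ΣF-cong {zero}  f≈g = refl
  ΣF-cong {suc n} f≈g = ∙-cong (f≈g Fin.zero) (ΣF-cong (f≈g ∘ Fin.suc))

  ΣF-vanish : ∀ {n} {f : Fin n → A} → (∀ i → f i ≈ ε) → ΣF f ≈ ε
  ΣF-vanish {zero}  f≈ε = refl
  ΣF-vanish {suc n} f≈ε = trans (∙-cong (f≈ε Fin.zero) (ΣF-vanish (f≈ε ∘ Fin.suc))) ε∙ε≈ε

  ΣF-distrib : ∀ {n} (f g : Fin n → A) → ΣF (λ i → f i ∙ g i) ≈ (ΣF f ∙ ΣF g)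
  ΣF-distrib {zero}  f g = sym ε∙ε≈ε
  ΣF-distrib {suc n} f g =
    trans (∙-congˡ (ΣF-distrib (f ∘ Fin.suc) (g ∘ Fin.suc))) (interchange _ _ _ _)

  ΣF-single : ∀ n (f : ℕ → A) t → t < n → (∀ i → i ≢ t → f i ≈ ε) → ΣF {n} (f ∘ toℕ) ≈ f t
  ΣF-single (suc n) f zero    _         f≈ε =
    trans (∙-congˡ (ΣF-vanish {n} {f ∘ suc ∘ toℕ} (λ i → f≈ε (suc (toℕ i)) λ ()))) (identityʳ _)
  ΣF-single (suc n) f (suc t) (s≤s t<n) f≈ε =
    trans (∙-cong (f≈ε 0 λ ())
                  (ΣF-single n (f ∘ suc) t t<n (λ i i≢t → f≈ε (suc i) (i≢t ∘ suc-injective))))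
          (identityˡ _)

  ΣF-extractFirst : ∀ {n} → 1 ≤ n → (g h : ℕ → A) → h 0 ≈ ε → (∀ t → h (suc t) ≈ g (suc t)) →
                    ΣF {n} (g ∘ toℕ) ≈ (g 0 ∙ ΣF {n} (h ∘ toℕ))
  ΣF-extractFirst {suc n} (s≤s _) g h h0≈ε h≈g =
    ∙-congˡ (sym (trans (∙-cong h0≈ε (ΣF-cong {n} (h≈g ∘ toℕ))) (identityˡ _)))

  ΣP : ℕ → (ℕ → ℕ → A) → A
  ΣP n f = ΣF {n} (λ t → ΣF {toℕ t} (λ i → f (toℕ t) (toℕ i)))

  ΣP-vanish : ∀ n {f : ℕ → ℕ → A} → (∀ t i → f t i ≈ ε) → ΣP n f ≈ ε
  ΣP-vanish n f≈ε = ΣF-vanish {n} λ t → ΣF-vanish {toℕ t} λ i → f≈ε (toℕ t) (toℕ i)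

  ΣP-single : ∀ n (f : ℕ → ℕ → A) {Q J} → J < Q → Q < n →
              (∀ t i → t ≢ Q → f t i ≈ ε) → (∀ i → i ≢ J → f Q i ≈ ε) → ΣP n f ≈ f Q J
  ΣP-single n f {Q} {J} J<Q Q<n f≈ε f[Q]≈ε =
    trans (ΣF-single n (λ t → ΣF {t} (f t ∘ toℕ)) Q Q<n
                     (λ t t≢Q → ΣF-vanish {t} λ i → f≈ε t (toℕ i) t≢Q))
          (ΣF-single Q (f Q) J J<Q f[Q]≈ε)

  ΣT-cong : ∀ n {f g : ℕ → A} → (∀ i → i ≤ n → f i ≈ g i) → ΣT f n ≈ ΣT g n
  ΣT-cong zero    f≈g = f≈g 0 z≤n
  ΣT-cong (suc n) f≈g = ∙-cong (ΣT-cong n (λ i i≤n → f≈g i (m≤n⇒m≤1+n i≤n))) (f≈g (suc n) ≤-refl)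

  ΣT-distrib : ∀ n (f g : ℕ → A) → ΣT (λ i → f i ∙ g i) n ≈ (ΣT f n ∙ ΣT g n)
  ΣT-distrib zero    f g = refl
  ΣT-distrib (suc n) f g = trans (∙-congʳ (ΣT-distrib n f g)) (interchange _ _ _ _)

  ΣT-vanish : ∀ n {f : ℕ → A} → (∀ i → i ≤ n → f i ≈ ε) → ΣT f n ≈ ε
  ΣT-vanish zero    f≈ε = f≈ε 0 z≤n
  ΣT-vanish (suc n) f≈ε =
    trans (∙-cong (ΣT-vanish n (λ i i≤n → f≈ε i (m≤n⇒m≤1+n i≤n))) (f≈ε (suc n) ≤-refl)) ε∙ε≈ε

  ΣT-first : ∀ n {f : ℕ → A} → (∀ i → 1 ≤ i → f i ≈ ε) → ΣT f n ≈ f 0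
  ΣT-first zero    f≈ε = refl
  ΣT-first (suc n) f≈ε = trans (∙-cong (ΣT-first n f≈ε) (f≈ε (suc n) (s≤s z≤n))) (identityʳ _)

  ΣT-last : ∀ n {f : ℕ → A} → (∀ i → i < n → f i ≈ ε) → ΣT f n ≈ f n
  ΣT-last zero    f≈ε = refl
  ΣT-last (suc n) f≈ε = trans (∙-congʳ (ΣT-vanish n (λ i i≤n → f≈ε i (s≤s i≤n)))) (identityˡ _)

  ΣI-cong : ∀ {m} {f g : Idx m → A} → (∀ α → f α ≈ g α) → ΣI f ≈ ΣI g
  ΣI-cong f≈g = ∙-cong (f≈g nothing) (ΣF-cong λ q → ΣF-cong λ j → f≈g (just (q , j)))

  ΣI-vanish : ∀ {m} {f : Idx m → A} → (∀ α → f α ≈ ε) → ΣI f ≈ ε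
  ΣI-vanish {m} f≈ε =
    trans (∙-cong (f≈ε nothing) (ΣF-vanish λ q → ΣF-vanish λ j → f≈ε (just (q , j)))) ε∙ε≈ε

  ΣI-distrib : ∀ {m} (f g : Idx m → A) → ΣI (λ α → f α ∙ g α) ≈ (ΣI f ∙ ΣI g)
  ΣI-distrib {m} f g = trans (∙-congˡ pairs) (interchange _ _ _ _)
    where
      f′ g′ : (q : Fin m) → Fin (toℕ q) → A
      f′ q j = f (just (q , j))
      g′ q j = g (just (q , j))

      pairs : ΣF (λ q → ΣF λ j → f′ q j ∙ g′ q j) ≈ (ΣF (λ q → ΣF (f′ q)) ∙ ΣF (λ q → ΣF (g′ q)))
      pairs = trans (ΣF-cong λ q → ΣF-distrib (f′ q) (g′ q))
                    (ΣF-distrib (λ q → ΣF (f′ q)) (λ q → ΣF (g′ q)))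

  ΣI-head : ∀ {m} {f : Idx m → A} → (∀ p → f (just p) ≈ ε) → ΣI f ≈ f nothing
  ΣI-head {m} f≈ε = trans (∙-congˡ (ΣF-vanish λ q → ΣF-vanish λ j → f≈ε (q , j))) (identityʳ _)

  record IsAdditive (h : A → A) : Set (c ⊔ ℓ) where
    field
      homo    : ∀ x y → h (x ∙ y) ≈ (h x ∙ h y)
      ε-homo  : h ε ≈ ε

  module _ {h : A → A} (additive : IsAdditive h) where
    open IsAdditive additive

    ΣF-homo : ∀ {n} (f : Fin n → A) → h (ΣF f) ≈ ΣF (h ∘ f)
    ΣF-homo {zero}  f = ε-homo
    ΣF-homo {suc n} f = trans (homo _ _) (∙-congˡ (ΣF-homo (f ∘ Fin.suc)))

    ΣT-homo : ∀ n (f : ℕ → A) → h (ΣT f n) ≈ ΣT (h ∘ f) n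
    ΣT-homo zero    f = refl
    ΣT-homo (suc n) f = trans (homo _ _) (∙-congʳ (ΣT-homo n f))

    ΣI-homo : ∀ {m} (f : Idx m → A) → h (ΣI f) ≈ ΣI (h ∘ f)
    ΣI-homo f = trans (homo _ _)
      (∙-congˡ (trans (ΣF-homo (λ q → ΣF λ j → f (just (q , j))))
                      (ΣF-cong λ q → ΣF-homo (λ j → f (just (q , j))))))

  record IsAdditiveFunctional {b} {B : Set b} (S : (B → A) → A) : Set (c ⊔ ℓ ⊔ b) where
    field
      homo    : ∀ f g → S (λ x → f x ∙ g x) ≈ (S f ∙ S g)
      ε-homo  : S (λ _ → ε) ≈ ε

  module _ {b} {B : Set b} {S : (B → A) → A} (additive : IsAdditiveFunctional S) where
    open IsAdditiveFunctional additive

    ΣF-comm : ∀ {n} (f : Fin n → B → A) → S (λ x → ΣF (λ i → f i x)) ≈ ΣF (λ i → S (f i))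
    ΣF-comm {zero}  f = ε-homo
    ΣF-comm {suc n} f = trans (homo _ _) (∙-congˡ (ΣF-comm (f ∘ Fin.suc)))

    ΣI-comm : ∀ {m} (f : Idx m → B → A) → S (λ x → ΣI (λ α → f α x)) ≈ ΣI (λ α → S (f α))
    ΣI-comm f = trans (homo _ _)
      (∙-congˡ (trans (ΣF-comm (λ q x → ΣF λ j → f (just (q , j)) x))
                      (ΣF-cong λ q → ΣF-comm (λ j → f (just (q , j))))))

  ΣT-additive : ∀ n → IsAdditiveFunctional (λ f → ΣT f n)
  ΣT-additive n = record
    { homo   = ΣT-distrib n
    ; ε-homo = ΣT-vanish n (λ _ _ → refl)
    }

  ΣI-additive : ∀ m → IsAdditiveFunctional (ΣI {m})
  ΣI-additive m = record
    { homo   = ΣI-distrib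
    ; ε-homo = ΣI-vanish {m} (λ _ → refl)
    }

if-≟-≡ : ∀ {b} {B : Set b} {x y : ℕ} {u v : B} → x ≡ y → (if does (x ≟ y) then u else v) ≡ u
if-≟-≡ {x = x} {y} x≡y rewrite dec-true (x ≟ y) x≡y = ≡.refl

if-≟-≢ : ∀ {b} {B : Set b} {x y : ℕ} {u v : B} → x ≢ y → (if does (x ≟ y) then u else v) ≡ v
if-≟-≢ {x = x} {y} x≢y rewrite dec-false (x ≟ y) x≢y = ≡.refl

module Series {c ℓ c′ ℓ′} {K : CommutativeRing c ℓ} {Mod : Module K c′ ℓ′}
              (D : Dendriform Mod) (m : ℕ) where
  open Ops D m
  open CommutativeRing K using (0#; 1#; _*_; +-commutativeMonoid; *-congˡ; *-identityʳ; zeroʳ)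
    renaming (_≈_ to _≈k_; refl to ≈k-refl; trans to ≈k-trans; sym to ≈k-sym; reflexive to ≈k-reflexive)
  open Module Mod
  open Dendriform D
  open FiniteSums +ᴹ-commutativeMonoid
  module Sk = FiniteSums +-commutativeMonoid
  open import Algebra.Properties.CommutativeSemigroup
    (CommutativeMonoid.commutativeSemigroup +ᴹ-commutativeMonoid) using (interchange; xy∙z≈xz∙y)
  open import Relation.Binary.Reasoning.Setoid ≈ᴹ-setoid

  ≺-zeroʳ : ∀ x → (x ≺ 0ᴹ) ≈ᴹ 0ᴹ
  ≺-zeroʳ x = ≈ᴹ-trans (≺-cong ≈ᴹ-refl (≈ᴹ-sym (*ₗ-zeroˡ 0ᴹ)))
                (≈ᴹ-trans (≺-scalarʳ 0# x 0ᴹ) (*ₗ-zeroˡ _))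

  ≺-zeroˡ : ∀ x → (0ᴹ ≺ x) ≈ᴹ 0ᴹ
  ≺-zeroˡ x = ≈ᴹ-trans (≺-cong (≈ᴹ-sym (*ₗ-zeroˡ 0ᴹ)) ≈ᴹ-refl)
                (≈ᴹ-trans (≺-scalarˡ 0# 0ᴹ x) (*ₗ-zeroˡ _))

  ≻-zeroʳ : ∀ x → (x ≻ 0ᴹ) ≈ᴹ 0ᴹ
  ≻-zeroʳ x = ≈ᴹ-trans (≻-cong ≈ᴹ-refl (≈ᴹ-sym (*ₗ-zeroˡ 0ᴹ)))
                (≈ᴹ-trans (≻-scalarʳ 0# x 0ᴹ) (*ₗ-zeroˡ _))

  ≻-zeroˡ : ∀ x → (0ᴹ ≻ x) ≈ᴹ 0ᴹ
  ≻-zeroˡ x = ≈ᴹ-trans (≻-cong (≈ᴹ-sym (*ₗ-zeroˡ 0ᴹ)) ≈ᴹ-refl)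
                (≈ᴹ-trans (≻-scalarˡ 0# 0ᴹ x) (*ₗ-zeroˡ _))

  ≺-additiveʳ : ∀ x → IsAdditive (x ≺_)
  ≺-additiveʳ x = record { homo = ≺-distribˡ x ; ε-homo = ≺-zeroʳ x }

  ≻-additiveʳ : ∀ x → IsAdditive (x ≻_)
  ≻-additiveʳ x = record { homo = ≻-distribˡ x ; ε-homo = ≻-zeroʳ x }

  ≻-additiveˡ : ∀ y → IsAdditive (_≻ y)
  ≻-additiveˡ y = record { homo = λ x x′ → ≻-distribʳ x x′ y ; ε-homo = ≻-zeroˡ y }

  ≻AC-zeroʳ : ∀ V {y} → y ≈ᴹ 0ᴹ → (V ≻AC y) ≈S 0S
  ≻AC-zeroʳ V y≈0 n = ≈ᴹ-trans (+ᴹ-cong (≈ᴹ-trans (≻-cong ≈ᴹ-refl y≈0) (≻-zeroʳ _))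
                                       (≈ᴹ-trans (*ₗ-congˡ y≈0) (*ₗ-zeroʳ _)))
                               (+ᴹ-identityˡ 0ᴹ)

  injA-≻AC : ∀ f y → (injA f ≻AC y) ≈S (f ≻SC y)
  injA-≻AC f y n = ≈ᴹ-trans (+ᴹ-congˡ (*ₗ-zeroˡ y)) (+ᴹ-identityʳ _)

  shift-suc : ∀ j f n → shift (suc j) f (suc n) ≡ shift j f n
  shift-suc j f n with suc j ≤? suc n | j ≤? n
  ... | yes _       | yes _ = ≡.refl
  ... | yes (s≤s p) | no ¬p = ⊥-elim (¬p p)
  ... | no ¬p       | yes p = ⊥-elim (¬p (s≤s p))
  ... | no _        | no _  = ≡.refl

  shift-cong : ∀ j {f g} → f ≈S g → shift j f ≈S shift j g
  shift-cong j f≈g n with j ≤? n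
  ... | yes _ = f≈g _
  ... | no  _ = ≈ᴹ-refl

  shift-≻ : ∀ j f y n → shift j (f ≻SC y) n ≈ᴹ (shift j f n ≻ y)
  shift-≻ j f y n with j ≤? n
  ... | yes _ = ≈ᴹ-refl
  ... | no  _ = ≈ᴹ-sym (≻-zeroˡ y)

  Solves : (I → Ser C) → Mat C → (I → ASer) → Set ℓ′
  Solves e N V = ∀ β → dpart (V β) ≈S (e β +S shift 1 (vecSucc V N β))

  solution-unique : ∀ {e e′ N V V′} → (∀ β → e β ≈S e′ β) → (∀ β → spart (V β) ≈Sk spart (V′ β)) →
                    Solves e N V → Solves e′ N V′ → ∀ β → V β ≈A V′ β
  solution-unique {e} {e′} {N} {V} {V′} e≈e′ s≈s′ sol sol′ β = (λ n → go n β) , s≈s′ β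
    where
      go : ∀ n β → dpart (V β) n ≈ᴹ dpart (V′ β) n
      go zero    β = ≈ᴹ-trans (sol β 0) (≈ᴹ-trans (+ᴹ-congʳ (e≈e′ β 0)) (≈ᴹ-sym (sol′ β 0)))
      go (suc n) β = begin
        dpart (V β) (suc n)                     ≈⟨ sol β (suc n) ⟩
        e β (suc n) +ᴹ vecSucc V N β n          ≈⟨ +ᴹ-cong (e≈e′ β (suc n)) (ΣI-cong step) ⟩
        e′ β (suc n) +ᴹ vecSucc V′ N β n        ≈⟨ sol′ β (suc n) ⟨
        dpart (V′ β) (suc n)                    ∎
        where
          step : ∀ α → (V α ≻AC N α β) n ≈ᴹ (V′ α ≻AC N α β) n
          step α = +ᴹ-cong (≻-cong (go n α) ≈ᴹ-refl) (*ₗ-congʳ (s≈s′ α n))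

  sum1to-suc : ∀ (F : ℕ → Ser C) n → sum1to F (suc n) ≈S (F 1 +S sum1to (F ∘ suc) n)
  sum1to-suc F zero    x = ≈ᴹ-trans (+ᴹ-identityˡ _) (≈ᴹ-sym (+ᴹ-identityʳ _))
  sum1to-suc F (suc n) x = ≈ᴹ-trans (+ᴹ-congʳ (sum1to-suc F n x)) (+ᴹ-assoc _ _ _)

  sum1to-ΣF : ∀ (F : ℕ → Ser C) n x → sum1to F n x ≈ᴹ ΣF {n} (λ i → F (suc (toℕ i)) x)
  sum1to-ΣF F zero    x = ≈ᴹ-refl
  sum1to-ΣF F (suc n) x = ≈ᴹ-trans (sum1to-suc F n x) (+ᴹ-congˡ (sum1to-ΣF (F ∘ suc) n x))

  -- The columns of V ≻ M_m for the row vector V with V_0 = X and V_(q′,j′) = v (toℕ q′) (toℕ j′),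
  -- with pair indices read as naturals, (q′,j′) standing for (q,j) = (q′+1,j′+1) as in Mm.
  -- For v = Ypair X a, vecSucc (Yvec X a) (Mm a) unfolds definitionally to these columns.
  module Columns (a : ℕ → ℕ → C) (X : ASer) (v : ℕ → ℕ → Ser C) where

    M-pair-first : ℕ → ℕ → C
    M-pair-first t i = if does (suc (suc i) ≟ suc t) then a (suc t) (suc t) else 0ᴹ

    M-first-pair : ℕ → ℕ → C
    M-first-pair Q J = if does (suc J ≟ 1) then a (suc Q) 1 else 0ᴹ

    M-pair-pair : ℕ → ℕ → ℕ → ℕ → C
    M-pair-pair t i Q J =
      if does (suc t ≟ suc Q) then (if does (suc J ≟ suc (suc i)) then a (suc t) (suc (suc i)) else 0ᴹ)
      else 0ᴹ

    firstColumn : Ser C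
    firstColumn k = (X ≻AC a 1 1) k +ᴹ ΣP m (λ t i → (injA (v t i) ≻AC M-pair-first t i) k)

    pairColumn : ℕ → ℕ → Ser C
    pairColumn Q J k =
      (X ≻AC M-first-pair Q J) k +ᴹ ΣP m (λ t i → (injA (v t i) ≻AC M-pair-pair t i Q J) k)

    firstColumn-sum : ∀ k → 1 ≤ m → (F : ℕ → C) → F 0 ≈ᴹ (X ≻AC a 1 1) k →
                      (∀ t → F (suc t) ≈ᴹ (v (suc t) t k ≻ a (suc (suc t)) (suc (suc t)))) →
                      ΣF {m} (F ∘ toℕ) ≈ᴹ firstColumn k
    firstColumn-sum k 1≤m F F0 F-suc =
      ≈ᴹ-trans (ΣF-extractFirst 1≤m F diagonal ≈ᴹ-refl diagonal≈F) (+ᴹ-congʳ F0)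
      where
        entry : ℕ → ℕ → C
        entry t i = (injA (v t i) ≻AC M-pair-first t i) k

        diagonal : ℕ → C
        diagonal t = ΣF {t} (entry t ∘ toℕ)

        diagonal≈F : ∀ t → diagonal (suc t) ≈ᴹ F (suc t)
        diagonal≈F t = begin
          diagonal (suc t)
            ≈⟨ ΣF-single (suc t) (entry (suc t)) t (n<1+n t)
                 (λ i i≢t → ≻AC-zeroʳ (injA (v (suc t) i))
                              (≈ᴹ-reflexive (if-≟-≢ (i≢t ∘ suc-injective ∘ suc-injective))) k) ⟩
          entry (suc t) t
            ≈⟨ injA-≻AC (v (suc t) t) _ k ⟩
          v (suc t) t k ≻ M-pair-first (suc t) t
            ≈⟨ ≻-cong ≈ᴹ-refl (≈ᴹ-reflexive (if-≟-≡ {x = suc (suc t)} ≡.refl)) ⟩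
          v (suc t) t k ≻ a (suc (suc t)) (suc (suc t))
            ≈⟨ F-suc t ⟨
          F (suc t) ∎

    pairColumn-first : ∀ Q → pairColumn Q 0 ≈S (X ≻AC a (suc Q) 1)
    pairColumn-first Q k =
      ≈ᴹ-trans (+ᴹ-congˡ (ΣP-vanish m λ t i →
                  ≻AC-zeroʳ (injA (v t i)) (≈ᴹ-reflexive (if-eta (does (suc t ≟ suc Q)))) k))
               (+ᴹ-identityʳ _)

    pairColumn-next : ∀ Q J → suc J < Q → Q < m →
                      pairColumn Q (suc J) ≈S ((v Q J) ≻SC a (suc Q) (suc (suc J)))
    pairColumn-next Q J sJ<Q Q<m k = begin
      pairColumn Q (suc J) k
        ≈⟨ +ᴹ-cong (≻AC-zeroʳ X ≈ᴹ-refl k)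
                   (ΣP-single m entry (<-trans (n<1+n J) sJ<Q) Q<m
                      (λ t i t≢Q → ≻AC-zeroʳ (injA (v t i))
                                     (≈ᴹ-reflexive (if-≟-≢ (t≢Q ∘ suc-injective))) k)
                      (λ i i≢J → ≻AC-zeroʳ (injA (v Q i)) (≈ᴹ-reflexive
                        (≡.trans (if-≟-≡ {x = suc Q} ≡.refl)
                               (if-≟-≢ (i≢J ∘ ≡.sym ∘ suc-injective ∘ suc-injective)))) k)) ⟩
      0ᴹ +ᴹ entry Q J
        ≈⟨ ≈ᴹ-trans (+ᴹ-identityˡ _) (injA-≻AC (v Q J) _ k) ⟩
      v Q J k ≻ M-pair-pair Q J Q (suc J)
        ≈⟨ ≻-cong ≈ᴹ-refl (≈ᴹ-reflexive
             (≡.trans (if-≟-≡ {x = suc Q} ≡.refl) (if-≟-≡ {x = suc (suc J)} ≡.refl))) ⟩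
      v Q J k ≻ a (suc Q) (suc (suc J)) ∎
      where
        entry : ℕ → ℕ → C
        entry t i = (injA (v t i) ≻AC M-pair-pair t i Q (suc J)) k

  Ypair : ASer → (ℕ → ℕ → C) → ℕ → ℕ → Ser C
  Ypair X a t i = shift (suc i) (omegaAux X a (suc t) i)

  Yvec-spart : ∀ a a00 X → X ≈A (constA a00 +AD sum1to (λ q → shift q (omega X a q q)) m) →
               ∀ β → spart (Yvec X a β) ≈Sk spart (evec a00 β)
  Yvec-spart a a00 X hX nothing  = proj₂ hX
  Yvec-spart a a00 X hX (just p) = λ _ → ≈k-refl

  Yvec-solves : ∀ a a00 X → 1 ≤ m → X ≈A (constA a00 +AD sum1to (λ q → shift q (omega X a q q)) m) →
                Solves (dpart ∘ evec a00) (Mm a) (Yvec X a)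
  Yvec-solves a a00 X 1≤m hX = solves
    where
      open Columns a X (Ypair X a)

      F : ℕ → Ser C
      F q = shift q (omega X a q q)

      firstRow : sum1to F m ≈S shift 1 (vecSucc (Yvec X a) (Mm a) nothing)
      firstRow zero    = ≈ᴹ-trans (sum1to-ΣF F m 0)
                           (ΣF-vanish {m} λ i → ≈ᴹ-refl)
      firstRow (suc k) = ≈ᴹ-trans (sum1to-ΣF F m (suc k))
                           (firstColumn-sum k 1≤m (λ t → F (suc t) (suc k)) ≈ᴹ-refl lastStep)
        where
          lastStep : ∀ t → F (suc (suc t)) (suc k) ≈ᴹ
                           (Ypair X a (suc t) t k ≻ a (suc (suc t)) (suc (suc t)))
          lastStep t = ≈ᴹ-trans (≈ᴹ-reflexive (shift-suc (suc t) _ k)) (shift-≻ (suc t) _ _ k)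

      pairRow : ∀ Q J k → J < Q → Q < m → shift J (omegaAux X a (suc Q) J) k ≈ᴹ pairColumn Q J k
      pairRow Q zero    k _   _   = ≈ᴹ-sym (pairColumn-first Q k)
      pairRow Q (suc J) k J<Q Q<m =
        ≈ᴹ-trans (shift-≻ (suc J) _ _ k) (≈ᴹ-sym (pairColumn-next Q J J<Q Q<m k))

      solves : Solves (dpart ∘ evec a00) (Mm a) (Yvec X a)
      solves nothing        n       = ≈ᴹ-trans (proj₁ hX n) (+ᴹ-congˡ (firstRow n))
      solves (just (q , j)) zero    = ≈ᴹ-sym (+ᴹ-identityˡ 0ᴹ)
      solves (just (q , j)) (suc k) =
        ≈ᴹ-trans (≈ᴹ-reflexive (shift-suc (toℕ j) _ k))
                 (≈ᴹ-trans (pairRow (toℕ q) (toℕ j) k (toℕ<n j) (toℕ<n q)) (≈ᴹ-sym (+ᴹ-identityˡ _)))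

  evec-δ0-diag : ∀ d s β → dpart (evec (d , s) β) ≈S (λ x → δ0 x *ₗ diag d nothing β)
  evec-δ0-diag d s nothing  zero    = ≈ᴹ-sym (*ₗ-identityˡ d)
  evec-δ0-diag d s nothing  (suc x) = ≈ᴹ-sym (*ₗ-zeroˡ d)
  evec-δ0-diag d s (just p) x       = ≈ᴹ-sym (*ₗ-zeroʳ _)

  evec-vanish : ∀ {d} s → d ≈ᴹ 0ᴹ → ∀ β → dpart (evec (d , s) β) ≈S 0S
  evec-vanish s d≈0 nothing  zero    = d≈0
  evec-vanish s d≈0 nothing  (suc x) = ≈ᴹ-refl
  evec-vanish s d≈0 (just p) x       = ≈ᴹ-refl

  evec-spart-vanish : ∀ d {s} → s ≈k 0# → ∀ β → spart (evec (d , s) β) ≈Sk (λ _ → 0#)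
  evec-spart-vanish d s≈0 nothing  zero    = s≈0
  evec-spart-vanish d s≈0 nothing  (suc x) = ≈k-refl
  evec-spart-vanish d s≈0 (just p) x       = ≈k-refl

  δ0-pos : ∀ {x} → 0 < x → δ0 x ≡ 0#
  δ0-pos {suc x} _ = ≡.refl

  ·ₛ-δ0 : ∀ {s} → s ≈Sk δ0 → ∀ f → (s ·ₛ f) ≈S f
  ·ₛ-δ0 {s} s≈δ0 f x =
    ≈ᴹ-trans (ΣT-first x λ { (suc i) _ → ≈ᴹ-trans (*ₗ-congʳ (s≈δ0 (suc i))) (*ₗ-zeroˡ _) })
             (≈ᴹ-trans (*ₗ-congʳ (s≈δ0 0)) (*ₗ-identityˡ _))

  ΣT-δ0-reversed : ∀ {s} → s ≈Sk δ0 → ∀ (f : ℕ → C) x → ΣT (λ i → s (x ∸ i) *ₗ f i) x ≈ᴹ f x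
  ΣT-δ0-reversed {s} s≈δ0 f x =
    ≈ᴹ-trans (ΣT-last x λ i i<x →
                ≈ᴹ-trans (*ₗ-congʳ (≈k-trans (s≈δ0 _) (≈k-reflexive (δ0-pos (m<n⇒0<n∸m i<x)))))
                         (*ₗ-zeroˡ _))
             (≈ᴹ-trans (*ₗ-congʳ (≈k-trans (≈k-reflexive (cong s (n∸n≡0 x))) (s≈δ0 0))) (*ₗ-identityˡ _))

  module _ (a : ℕ → ℕ → C) (Z : AMat) (hZ : Z ≈AM amat (λ i j → shift 1 ((Z ≻AM Mm a) i j)) δ0) where
    M : Mat C
    M = Mm a

    B : Mat (Ser C)
    B = mat Z

    ≻AM-firstRow : ∀ β → (Z ≻AM M) nothing β ≈S vecSucc (entryA Z nothing) M β
    ≻AM-firstRow β x = ≈ᴹ-sym (≈ᴹ-trans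
      (ΣI-distrib (λ α → B nothing α x ≻ M α β) (λ α → spart (entryA Z nothing α) x *ₗ M α β))
      (+ᴹ-congˡ (ΣI-head {m} {λ α → spart (entryA Z nothing α) x *ₗ M α β} (λ p → *ₗ-zeroˡ _))))

    firstRow-solves : Solves (λ _ → 0S) M (entryA Z nothing)
    firstRow-solves β n = begin
      B nothing β n                               ≈⟨ proj₁ hZ nothing β n ⟩
      shift 1 ((Z ≻AM M) nothing β) n             ≈⟨ shift-cong 1 (≻AM-firstRow β) n ⟩
      shift 1 (vecSucc (entryA Z nothing) M β) n  ≈⟨ +ᴹ-identityˡ _ ⟨
      0ᴹ +ᴹ shift 1 (vecSucc (entryA Z nothing) M β) n ∎

    evec-spart-firstRow : ∀ d {s} → s ≈k 1# → ∀ β → spart (evec (d , s) β) ≈Sk spart (entryA Z nothing β)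
    evec-spart-firstRow d s≈1 nothing  zero    = ≈k-trans s≈1 (≈k-sym (proj₂ hZ 0))
    evec-spart-firstRow d s≈1 nothing  (suc x) = ≈k-sym (proj₂ hZ (suc x))
    evec-spart-firstRow d s≈1 (just p) x       = ≈k-refl

    module _ (Zinv : AMat) (Zinv*Z≈1 : (Zinv *AM Z) ≈AM 1AM) (d : C) where

      A : Mat (Ser C)
      A = mat Zinv

      dd : I → C
      dd = diag d nothing

      V : I → Ser C
      V = (diag d ≺CA Zinv) nothing

      W : I → Ser C
      W = ((diag d ≺CA Zinv) *SA Z) nothing

      sc-Zinv≈δ0 : sc Zinv ≈Sk δ0
      sc-Zinv≈δ0 x = ≈k-trans (≈k-sym (≈k-trans (Sk.ΣT-last x early) last)) (proj₂ Zinv*Z≈1 x)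
        where
          early : ∀ i → i < x → (sc Zinv i * sc Z (x ∸ i)) ≈k 0#
          early i i<x =
            ≈k-trans (*-congˡ (≈k-trans (proj₂ hZ _) (≈k-reflexive (δ0-pos (m<n⇒0<n∸m i<x))))) (zeroʳ _)
          last : (sc Zinv x * sc Z (x ∸ x)) ≈k sc Zinv x
          last = ≈k-trans (*-congˡ (≈k-trans (≈k-reflexive (cong (sc Z) (n∸n≡0 x))) (proj₂ hZ 0)))
                          (*-identityʳ _)

      V≈ : ∀ κ x → V κ x ≈ᴹ ((d ≺ A nothing κ x) +ᴹ (δ0 x *ₗ dd κ))
      V≈ κ x = +ᴹ-cong (ΣI-head {m} {λ ι → dd ι ≺ A ι κ x} (λ p → ≺-zeroˡ _)) (*ₗ-congʳ (sc-Zinv≈δ0 x))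

      W≈ : ∀ β x → W β x ≈ᴹ (ΣI (λ κ → convD _∗_ (V κ) (B κ β) x) +ᴹ V β x)
      W≈ β x = +ᴹ-congˡ (·ₛ-δ0 (proj₂ hZ) (V β) x)

      W-split : ∀ β x → W β x ≈ᴹ ((ΣI (λ κ → convD _≺_ (V κ) (B κ β) x) +ᴹ V β x)
                                  +ᴹ ΣI (λ κ → convD _≻_ (V κ) (B κ β) x))
      W-split β x = ≈ᴹ-trans (W≈ β x)
        (≈ᴹ-trans (+ᴹ-congʳ (≈ᴹ-trans (ΣI-cong split) (ΣI-distrib conv≺ conv≻))) (xy∙z≈xz∙y _ _ _))
        where
          conv≺ conv≻ : I → C
          conv≺ κ = convD _≺_ (V κ) (B κ β) x
          conv≻ κ = convD _≻_ (V κ) (B κ β) x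

          split : ∀ κ → convD _∗_ (V κ) (B κ β) x ≈ᴹ (conv≺ κ +ᴹ conv≻ κ)
          split κ = ΣT-distrib x (λ i → V κ i ≺ B κ β (x ∸ i)) (λ i → V κ i ≻ B κ β (x ∸ i))

      conv-≺-V : ∀ κ β x → convD _≺_ (V κ) (B κ β) x ≈ᴹ
                            ((d ≺ convD _∗_ (A nothing κ) (B κ β) x) +ᴹ (dd κ ≺ B κ β x))
      conv-≺-V κ β x = begin
        convD _≺_ (V κ) (B κ β) x
          ≈⟨ ΣT-cong x (λ i _ → ≈ᴹ-trans (≺-cong (V≈ κ i) ≈ᴹ-refl) (≺-distribʳ _ _ _)) ⟩
        ΣT (λ i → ((d ≺ A nothing κ i) ≺ B κ β (x ∸ i)) +ᴹ ((δ0 i *ₗ dd κ) ≺ B κ β (x ∸ i))) x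
          ≈⟨ ΣT-distrib x _ _ ⟩
        ΣT (λ i → (d ≺ A nothing κ i) ≺ B κ β (x ∸ i)) x +ᴹ ΣT (λ i → (δ0 i *ₗ dd κ) ≺ B κ β (x ∸ i)) x
          ≈⟨ +ᴹ-cong (≈ᴹ-trans (ΣT-cong x λ i _ → dend₁ d _ _)
                               (≈ᴹ-sym (ΣT-homo (≺-additiveʳ d) x λ i → A nothing κ i ∗ B κ β (x ∸ i))))
                     (≈ᴹ-trans (ΣT-first x λ { (suc i) _ →
                                  ≈ᴹ-trans (≺-cong (*ₗ-zeroˡ _) ≈ᴹ-refl) (≺-zeroˡ _) })
                               (≺-cong (*ₗ-identityˡ _) ≈ᴹ-refl)) ⟩
        (d ≺ convD _∗_ (A nothing κ) (B κ β) x) +ᴹ (dd κ ≺ B κ β x) ∎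

      Zinv*Z-firstRow : ∀ β x →
        ((ΣI (λ κ → convD _∗_ (A nothing κ) (B κ β) x) +ᴹ A nothing β x) +ᴹ B nothing β x) ≈ᴹ 0ᴹ
      Zinv*Z-firstRow β x =
        ≈ᴹ-trans (≈ᴹ-sym (+ᴹ-cong (+ᴹ-congˡ (·ₛ-δ0 (proj₂ hZ) (A nothing β) x))
                                  (·ₛ-δ0 sc-Zinv≈δ0 (B nothing β) x)))
                 (proj₁ Zinv*Z≈1 nothing β x)

      W-≺-half : ∀ β x → (ΣI (λ κ → convD _≺_ (V κ) (B κ β) x) +ᴹ V β x) ≈ᴹ (δ0 x *ₗ dd β)
      W-≺-half β x = begin
        ΣI (λ κ → convD _≺_ (V κ) (B κ β) x) +ᴹ V β x
          ≈⟨ +ᴹ-cong (≈ᴹ-trans (ΣI-cong λ κ → conv-≺-V κ β x)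
                               (ΣI-distrib (λ κ → d ≺ Σ∗ κ) (λ κ → dd κ ≺ B κ β x)))
                     (V≈ β x) ⟩
        (ΣI (λ κ → d ≺ Σ∗ κ) +ᴹ ΣI (λ κ → dd κ ≺ B κ β x)) +ᴹ ((d ≺ A nothing β x) +ᴹ (δ0 x *ₗ dd β))
          ≈⟨ +ᴹ-congʳ (+ᴹ-cong (≈ᴹ-sym (ΣI-homo (≺-additiveʳ d) Σ∗))
                               (ΣI-head {m} {λ κ → dd κ ≺ B κ β x} (λ p → ≺-zeroˡ _))) ⟩
        ((d ≺ ΣI Σ∗) +ᴹ (d ≺ B nothing β x)) +ᴹ ((d ≺ A nothing β x) +ᴹ (δ0 x *ₗ dd β))
          ≈⟨ ≈ᴹ-trans (interchange _ _ _ _) (≈ᴹ-sym (+ᴹ-assoc _ _ _)) ⟩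
        (((d ≺ ΣI Σ∗) +ᴹ (d ≺ A nothing β x)) +ᴹ (d ≺ B nothing β x)) +ᴹ (δ0 x *ₗ dd β)
          ≈⟨ +ᴹ-congʳ (≈ᴹ-sym (≈ᴹ-trans (≺-distribˡ d _ _) (+ᴹ-congʳ (≺-distribˡ d _ _)))) ⟩
        (d ≺ ((ΣI Σ∗ +ᴹ A nothing β x) +ᴹ B nothing β x)) +ᴹ (δ0 x *ₗ dd β)
          ≈⟨ +ᴹ-congʳ (≈ᴹ-trans (≺-cong ≈ᴹ-refl (Zinv*Z-firstRow β x)) (≺-zeroʳ d)) ⟩
        0ᴹ +ᴹ (δ0 x *ₗ dd β)
          ≈⟨ +ᴹ-identityˡ _ ⟩
        δ0 x *ₗ dd β ∎
        where
          Σ∗ : I → C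
          Σ∗ κ = convD _∗_ (A nothing κ) (B κ β) x

      conv-≻-shift : ∀ κ β k →
                     convD _≻_ (V κ) (B κ β) (suc k) ≈ᴹ ΣT (λ i → V κ i ≻ (Z ≻AM M) κ β (k ∸ i)) k
      conv-≻-shift κ β k = ≈ᴹ-trans (+ᴹ-cong (ΣT-cong k early) last) (+ᴹ-identityʳ _)
        where
          early : ∀ i → i ≤ k → (V κ i ≻ B κ β (suc k ∸ i)) ≈ᴹ (V κ i ≻ (Z ≻AM M) κ β (k ∸ i))
          early i i≤k = ≻-cong ≈ᴹ-refl
            (≈ᴹ-trans (proj₁ hZ κ β (suc k ∸ i))
                      (≈ᴹ-reflexive (cong (shift 1 ((Z ≻AM M) κ β)) (+-∸-assoc 1 i≤k))))
          last : (V κ (suc k) ≻ B κ β (k ∸ k)) ≈ᴹ 0ᴹ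
          last = ≈ᴹ-trans (≻-cong ≈ᴹ-refl (≈ᴹ-trans (≈ᴹ-reflexive (cong (B κ β) (n∸n≡0 k)))
                                                    (proj₁ hZ κ β 0)))
                          (≻-zeroʳ _)

      ≻-≻AM : ∀ κ β i y → (V κ i ≻ (Z ≻AM M) κ β y) ≈ᴹ
                           (ΣI (λ ι → (V κ i ∗ B κ ι y) ≻ M ι β) +ᴹ (sc Z y *ₗ (V κ i ≻ M κ β)))
      ≻-≻AM κ β i y = ≈ᴹ-trans (≻-distribˡ _ _ _)
        (+ᴹ-cong (≈ᴹ-trans (ΣI-homo (≻-additiveʳ (V κ i)) (λ ι → B κ ι y ≻ M ι β))
                           (ΣI-cong λ ι → dend₃ (V κ i) (B κ ι y) (M ι β)))
                 (≻-scalarʳ _ _ _))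

      conv-≻-V : ∀ κ β k → convD _≻_ (V κ) (B κ β) (suc k) ≈ᴹ
                            (ΣI (λ ι → convD _∗_ (V κ) (B κ ι) k ≻ M ι β) +ᴹ (V κ k ≻ M κ β))
      conv-≻-V κ β k = begin
        convD _≻_ (V κ) (B κ β) (suc k)
          ≈⟨ conv-≻-shift κ β k ⟩
        ΣT (λ i → V κ i ≻ (Z ≻AM M) κ β (k ∸ i)) k
          ≈⟨ ≈ᴹ-trans (ΣT-cong k λ i _ → ≻-≻AM κ β i (k ∸ i)) (ΣT-distrib k _ _) ⟩
        ΣT (λ i → ΣI (λ ι → (V κ i ∗ B κ ι (k ∸ i)) ≻ M ι β)) k +ᴹ
        ΣT (λ i → sc Z (k ∸ i) *ₗ (V κ i ≻ M κ β)) k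
          ≈⟨ +ᴹ-cong (≈ᴹ-trans (ΣI-comm (ΣT-additive k) (λ ι i → (V κ i ∗ B κ ι (k ∸ i)) ≻ M ι β))
                               (ΣI-cong λ ι → ≈ᴹ-sym (ΣT-homo (≻-additiveˡ (M ι β)) k
                                                               λ i → V κ i ∗ B κ ι (k ∸ i))))
                     (ΣT-δ0-reversed (proj₂ hZ) (λ i → V κ i ≻ M κ β) k) ⟩
        ΣI (λ ι → convD _∗_ (V κ) (B κ ι) k ≻ M ι β) +ᴹ (V κ k ≻ M κ β) ∎

      W-≻-half : ∀ β x → ΣI (λ κ → convD _≻_ (V κ) (B κ β) x) ≈ᴹ shift 1 (vecSucc (injA ∘ W) M β) x
      W-≻-half β zero    = ΣI-vanish {m} λ κ → ≈ᴹ-trans (≻-cong ≈ᴹ-refl (proj₁ hZ κ β 0)) (≻-zeroʳ (V κ 0))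
      W-≻-half β (suc k) = begin
        ΣI (λ κ → convD _≻_ (V κ) (B κ β) (suc k))
          ≈⟨ ≈ᴹ-trans (ΣI-cong λ κ → conv-≻-V κ β k)
                      (ΣI-distrib (λ κ → ΣI λ ι → Σ∗ κ ι ≻ M ι β) (λ κ → V κ k ≻ M κ β)) ⟩
        ΣI (λ κ → ΣI λ ι → Σ∗ κ ι ≻ M ι β) +ᴹ ΣI (λ κ → V κ k ≻ M κ β)
          ≈⟨ +ᴹ-congʳ (≈ᴹ-trans (ΣI-comm (ΣI-additive m) (λ ι κ → Σ∗ κ ι ≻ M ι β))
                                (ΣI-cong λ ι → ≈ᴹ-sym (ΣI-homo (≻-additiveˡ (M ι β)) (λ κ → Σ∗ κ ι)))) ⟩
        ΣI (λ ι → ΣI (λ κ → Σ∗ κ ι) ≻ M ι β) +ᴹ ΣI (λ ι → V ι k ≻ M ι β)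
          ≈⟨ ΣI-distrib (λ ι → ΣI (λ κ → Σ∗ κ ι) ≻ M ι β) (λ ι → V ι k ≻ M ι β) ⟨
        ΣI (λ ι → (ΣI (λ κ → Σ∗ κ ι) ≻ M ι β) +ᴹ (V ι k ≻ M ι β))
          ≈⟨ ΣI-cong (λ ι → ≈ᴹ-trans (≈ᴹ-sym (≻-distribʳ _ _ _))
                                     (≈ᴹ-trans (≻-cong (≈ᴹ-sym (W≈ ι k)) ≈ᴹ-refl)
                                               (≈ᴹ-sym (injA-≻AC (W ι) (M ι β) k)))) ⟩
        ΣI (λ ι → (injA (W ι) ≻AC M ι β) k) ∎
        where
          Σ∗ : I → I → C
          Σ∗ κ ι = convD _∗_ (V κ) (B κ ι) k

      W-solves : Solves (λ β x → δ0 x *ₗ dd β) M (injA ∘ W)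
      W-solves β x = ≈ᴹ-trans (W-split β x) (+ᴹ-cong (W-≺-half β x) (W-≻-half β x))

mainTheorem12 : ∀ {c ℓ c′ ℓ′} (K : CommutativeRing c ℓ) → IsField K → CharZero K →
    (Mod : Module K c′ ℓ′) (D : Dendriform Mod) (m : ℕ) → 1 ≤ m →
    let open Ops D m
    in (a : ℕ → ℕ → C) (a00 : Aug) (X : ASer) →
       X ≈A (constA a00 +AD sum1to (λ q → shift q (omega X a q q)) m) →
       (∀ β → Yvec X a β ≈A (evec a00 β +AD shift 1 (vecSucc (Yvec X a) (Mm a) β)))
       ×
       ((Z Zinv : AMat) →
        Z ≈AM amat (λ i j → shift 1 ((Z ≻AM Mm a) i j)) δ0 →
        (Z *AM Zinv) ≈AM 1AM → (Zinv *AM Z) ≈AM 1AM →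
        (proj₂ a00 ≈K 0K →
           ∀ β → Yvec X a β ≈A injA (((diag (proj₁ a00) ≺CA Zinv) *SA Z) nothing β))
        ×
        (proj₁ a00 ≈D 0D → proj₂ a00 ≈K 1K →
           ∀ β → Yvec X a β ≈A entryA Z nothing β))
mainTheorem12 K _ _ Mod D m 1≤m a (d , s) X hX =
  (λ β → Y-solves β , Y-spart β) ,
  λ Z Zinv hZ _ Zinv*Z≈1 →
    (λ s≈0 → solution-unique {N = Mm a} (evec-δ0-diag d s)
               (λ β x → ≈k-trans (Y-spart β x) (evec-spart-vanish d s≈0 β x))
               Y-solves (W-solves a Z hZ Zinv Zinv*Z≈1 d)) ,
    (λ d≈0 s≈1 → solution-unique {N = Mm a} (evec-vanish s d≈0)
                   (λ β x → ≈k-trans (Y-spart β x) (evec-spart-firstRow a Z hZ d s≈1 β x))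
                   Y-solves (firstRow-solves a Z hZ))
  where
    open Ops D m
    open Series D m
    open CommutativeRing K using () renaming (trans to ≈k-trans)

    Y-solves : Solves (dpart ∘ evec (d , s)) (Mm a) (Yvec X a)
    Y-solves = Yvec-solves a (d , s) X 1≤m hX

    Y-spart : ∀ β → spart (Yvec X a β) ≈Sk spart (evec (d , s) β)
    Y-spart = Yvec-spart a (d , s) X hX
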